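{- Let $A$ be a finite set of agents with $|A|\ge2$. For every formula $\varphi\in\mathcal{L}_{KS}$ and every maximally $\mathsf{SSL}$-consistent set $\Gamma$, $M^{\ast c},X^\ast_\Gamma\Vdash\varphi$ if and only if $\varphi\in\Gamma$.
   Context: The language $\mathcal{L}_{KS}$ over a countable set $\mathsf{Prop}$ of variables and agents $A$ is $\varphi::=p\mid\neg\varphi\mid(\varphi\wedge\varphi)\mid K_a\varphi\mid S_a\varphi$. The system $\mathsf{SSL}$ has axioms: all propositional tautologies; for each $a\in A$: (K) $K_a(\varphi\to\psi)\to(K_a\varphi\to K_a\psi)$, (T) $K_a\varphi\to\varphi$, (4) $K_a\varphi\to K_aK_a\varphi$, (5) $\neg K_a\varphi\to K_a\neg K_a\varphi$, (S1) $S_a\varphi\to K_a\varphi$, (S4) $S_a\varphi\to K_aS_a\varphi$; for distinct $a,b$: (S2) $S_a\varphi\to\neg K_b\varphi$. Rules: modus ponens; from $\varphi$ infer $K_a\varphi$; from $\vdash\varphi\leftrightarrow\psi$ infer $\vdash S_a\varphi\leftrightarrow S_a\psi$. A set is $\mathsf{SSL}$-consistent if no finite conjunction of its members implies $\bot$ provably; $\mathsf{MCS}$ is the set of maximally consistent sets. For $\Gamma,\Delta\in\mathsf{MCS}$: $\Gamma R_a\Delta$ iff $\{\varphi:K_a\varphi\in\Gamma\}\subseteq\Delta$; $[\Gamma]_a=\{\Delta:\Gamma R_a\Delta\}$. Auxiliary canonical model $M^{\ast c}$ (with a fresh colour $\ast\notin A$): vertices $(\ast,\Gamma)$ and $(a,[\Gamma]_a)$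 for $\Gamma\in\mathsf{MCS}$, $a\in A$; facets $X^\ast_\Gamma=\{(\ast,\Gamma)\}\cup\{(a,[\Gamma]_a):a\in A\}$, faces their downward closure; colouring $(\ast,\Gamma)\mapsto\ast$, $(a,[\Gamma]_a)\mapsto a$; valuation $\nu(X^\ast_\Gamma)=\{p\in\mathsf{Prop}:p\in\Gamma\}$; for $v=(a,[\Gamma]_a)$, $N_a^{S}(v)=\{\widehat{\varphi}^\ast:S_a\varphi\in\Gamma\}$ where $\widehat{\varphi}^\ast=\{X^\ast_\Delta:\varphi\in\Delta\}$. Satisfaction at facets: $p$ iff $p\in\nu(X)$; Boolean clauses as usual; $K_a\varphi$ holds at $X$ iff $\varphi$ holds at all facets $Y$ with the same colour-$a$ vertex as $X$; $S_a\varphi$ holds at $X$ iff $K_a\varphi$ holds at $X$ and the set of facets satisfying $\varphi$ belongs to $N_a^S$ of the colour-$a$ vertex of $X$. -}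

module Defs where

open import Data.Nat using (ℕ; zero; suc; _≤_)
open import Data.Fin using (Fin)
open import Data.Bool using (Bool; true; false; not; _∧_)
open import Data.List using (List; []; _∷_)
open import Data.List.Relation.Unary.All using (All)
open import Data.Product using (Σ; _×_; _,_; proj₁)
open import Relation.Binary.PropositionalEquality using (_≡_; _≢_)
open import Relation.Nullary using (¬_)
open import Level using (Lift)
open import Function.Bundles using (_⇔_)

module _ (n : ℕ) where

  Agent : Set
  Agent = Fin n

  data Fm : Set where
    var  : ℕ → Fm
    ~_   : Fm → Fm
    _∧'_ : Fm → Fm → Fm
    K    : Agent → Fm → Fm
    S    : Agent → Fm → Fm

  infixr 6 _∧'_
  infix 7 ~_

  _⇒_ : Fm → Fm → Fm
  φ ⇒ ψ = ~ (φ ∧' ~ ψ)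

  _⇔'_ : Fm → Fm → Fm
  φ ⇔' ψ = (φ ⇒ ψ) ∧' (ψ ⇒ φ)

  ⊥' : Fm
  ⊥' = var 0 ∧' ~ var 0

  ⊤' : Fm
  ⊤' = ~ ⊥'

  infixr 5 _⇒_

  -- Propositional tautologies: true under every Boolean assignment to the
  -- propositional atoms, where formulas K a φ and S a φ count as atoms.
  eval : (Fm → Bool) → Fm → Bool
  eval v (var p)  = v (var p)
  eval v (~ φ)    = not (eval v φ)
  eval v (φ ∧' ψ) = eval v φ ∧ eval v ψ
  eval v (K a φ)  = v (K a φ)
  eval v (S a φ)  = v (S a φ)

  Tautology : Fm → Set
  Tautology φ = ∀ (v : Fm → Bool) → eval v φ ≡ true

  data ⊢_ : Fm → Set where
    taut : ∀ {φ} → Tautology φ → ⊢ φ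
    axK  : ∀ {a φ ψ} → ⊢ (K a (φ ⇒ ψ) ⇒ (K a φ ⇒ K a ψ))
    axT  : ∀ {a φ} → ⊢ (K a φ ⇒ φ)
    ax4  : ∀ {a φ} → ⊢ (K a φ ⇒ K a (K a φ))
    ax5  : ∀ {a φ} → ⊢ (~ K a φ ⇒ K a (~ K a φ))
    axS1 : ∀ {a φ} → ⊢ (S a φ ⇒ K a φ)
    axS4 : ∀ {a φ} → ⊢ (S a φ ⇒ K a (S a φ))
    axS2 : ∀ {a b φ} → a ≢ b → ⊢ (S a φ ⇒ ~ K b φ)
    mp   : ∀ {φ ψ} → ⊢ (φ ⇒ ψ) → ⊢ φ → ⊢ ψ
    nec  : ∀ {a φ} → ⊢ φ → ⊢ K a φ
    reS  : ∀ {a φ ψ} → ⊢ (φ ⇔' ψ) → ⊢ (S a φ ⇔' S a ψ)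

  infix 3 ⊢_

  conj : List Fm → Fm
  conj []      = ⊤'
  conj (φ ∷ L) = φ ∧' conj L

  Consistent : (Fm → Set) → Set
  Consistent Γ = ¬ (Σ (List Fm) λ L → All Γ L × (⊢ (conj L ⇒ ⊥')))

  IsMCS : (Fm → Set) → Set₁
  IsMCS Γ = Consistent Γ ×
            (∀ (Δ : Fm → Set) → Consistent Δ → (∀ φ → Γ φ → Δ φ) → ∀ φ → Δ φ → Γ φ)

  MCS : Set₁
  MCS = Σ (Fm → Set) IsMCS

  R : Agent → MCS → MCS → Set
  R a (Γ , _) (Δ , _) = ∀ φ → Γ (K a φ) → Δ φ

  -- Facets X*_Γ of M*c are in bijection with MCSs Γ.  The colour-a vertex of
  -- X*_Γ is (a , [Γ]_a); two facets share it iff [Γ]_a = [Δ]_a as sets.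
  SameVertex : Agent → MCS → MCS → Set₁
  SameVertex a Γ Δ = ∀ (Θ : MCS) → R a Γ Θ ⇔ R a Δ Θ

  -- S clause: K_a φ holds, and the truth set of φ (a set of facets) belongs to
  -- N^S_a((a,[Γ]_a)) = { ψ̂* : S_a ψ ∈ Γ }, i.e. equals ψ̂* = {X*_Δ : ψ ∈ Δ}
  -- (set equality, extensionally) for some ψ with S_a ψ ∈ Γ.
  _⊩_ : MCS → Fm → Set₁
  X ⊩ var p    = Lift _ (proj₁ X (var p))
  X ⊩ (~ φ)    = ¬ (X ⊩ φ)
  X ⊩ (φ ∧' ψ) = (X ⊩ φ) × (X ⊩ ψ)
  X ⊩ K a φ    = ∀ (Y : MCS) → SameVertex a X Y → Y ⊩ φ
  X ⊩ S a φ    = (∀ (Y : MCS) → SameVertex a X Y → Y ⊩ φ) ×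
                 Σ Fm (λ ψ → proj₁ X (S a ψ) × (∀ (Y : MCS) → (Y ⊩ φ) ⇔ proj₁ Y ψ))

-- For K_a, axioms 4 and 5 make the facets sharing the colour-a vertex
-- of X*_Γ exactly the X*_Δ with Γ R_a Δ; so if K_a φ ∉ Γ, a Lindenbaum extension of
-- {χ : K_a χ ∈ Γ} ∪ {¬φ} is a facet at that vertex refuting φ.  For S_a, if the truth
-- set of φ is some ψ̂* with S_a ψ ∈ Γ, then φ and ψ lie in the same maximal consistent
-- sets, hence φ ↔ ψ is provable (again by Lindenbaum), and the congruence rule for S_a
-- turns S_a ψ ∈ Γ into S_a φ ∈ Γ.
module Submission where

import Defs as D
open D using (Fm; var; ~_; _∧'_; K; S; taut; axK; axT; ax4; ax5; axS1; mp; nec; reS)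
open import Data.Bool using (Bool; true; false; not; _∧_; T)
open import Data.Bool.Properties using (∧-inverseʳ; T-≡; T-∧)
open import Data.Fin using (Fin; zero; suc)
open import Data.List using (List; []; _∷_; _++_; concat; map; cartesianProductWith; allFin)
open import Data.List.Membership.Propositional using (_∈_)
open import Data.List.Membership.Propositional.Properties
  using (∈-map⁺; ∈-++⁺ˡ; ∈-++⁺ʳ; ∈-concat⁺′; ∈-cartesianProductWith⁺; ∈-allFin)
open import Data.List.Relation.Unary.All as All using (All; []; _∷_)
open import Data.List.Relation.Unary.All.Properties using (++⁺)
open import Data.List.Relation.Unary.Any using (here; there)
open import Data.Nat using (ℕ; zero; suc; _≤_; _⊔_; _≤′_; ≤′-refl; ≤′-step)
open import Data.Nat.Properties using (≤⇒≤′; m≤m⊔n; m≤n⊔m)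
open import Data.Product using (Σ; Σ-syntax; ∃-syntax; _,_; _×_; proj₁; proj₂)
open import Data.Product.Function.NonDependent.Propositional using (_×-⇔_)
open import Data.Sum using (_⊎_; inj₁; inj₂)
open import Data.Vec as Vec using (Vec; []; _∷_; lookup)
open import Data.Vec.Properties using (lookup-map)
open import Function using (_∘_)
open import Function.Bundles using (_⇔_; mk⇔; Equivalence)
open import Function.Construct.Composition using (_⇔-∘_)
open import Function.Construct.Symmetry using (⇔-sym)
open import Function.Related.TypeIsomorphisms using (¬-cong-⇔)
open import Level using (0ℓ; lift; lower)
open import Relation.Binary.PropositionalEquality using (_≡_; refl; sym; trans; cong; cong₂)
open import Relation.Nullary using (¬_)
open import Relation.Unary using (Pred; _⊆_; _∪_; ｛_｝; ∅)

open Equivalence using (to; from)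

module Canonical {n : ℕ} where

  Formula : Set
  Formula = Fm n

  Theory : Set₁
  Theory = Pred Formula 0ℓ

  private
    variable
      k : ℕ
      a : Fin n
      A B C φ ψ χ : Formula
      Γ Δ Θ : Theory

  infixr 5 _⇒_
  _⇒_ : Formula → Formula → Formula
  _⇒_ = D._⇒_ n

  _⇔′_ : Formula → Formula → Formula
  _⇔′_ = D._⇔'_ n

  ⊥′ ⊤′ : Formula
  ⊥′ = D.⊥' n
  ⊤′ = D.⊤' n

  infix 3 ⊢_
  ⊢_ : Formula → Set
  ⊢_ = D.⊢_ n

  infixr 5 _⇛_
  infixr 6 _⋀_

  data Schema (k : ℕ) : Set where
    atom   : Fin k → Schema k
    falsum : Schema k
    neg    : Schema k → Schema k
    _⋀_    : Schema k → Schema k → Schema k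

  _⇛_ : Schema k → Schema k → Schema k
  s ⇛ t = neg (s ⋀ neg t)

  verum : Schema k
  verum = neg falsum

  p : Schema (suc k)
  p = atom zero

  q : Schema (suc (suc k))
  q = atom (suc zero)

  r : Schema (suc (suc (suc k)))
  r = atom (suc (suc zero))

  ⟦_⟧ : Schema k → Vec Formula k → Formula
  ⟦ atom i ⟧  σ = lookup σ i
  ⟦ falsum ⟧  σ = ⊥′
  ⟦ neg s ⟧   σ = ~ ⟦ s ⟧ σ
  ⟦ s ⋀ t ⟧   σ = ⟦ s ⟧ σ ∧' ⟦ t ⟧ σ

  value : Schema k → Vec Bool k → Bool
  value (atom i)  ρ = lookup ρ i
  value falsum    ρ = false
  value (neg s)   ρ = not (value s ρ)
  value (s ⋀ t)   ρ = value s ρ ∧ value t ρ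

  eval-⟦⟧ : ∀ v (s : Schema k) σ → D.eval n v (⟦ s ⟧ σ) ≡ value s (Vec.map (D.eval n v) σ)
  eval-⟦⟧ v (atom i) σ = sym (lookup-map i (D.eval n v) σ)
  eval-⟦⟧ v falsum   σ = ∧-inverseʳ (v (var 0))
  eval-⟦⟧ v (neg s)  σ = cong not (eval-⟦⟧ v s σ)
  eval-⟦⟧ v (s ⋀ t)  σ = cong₂ _∧_ (eval-⟦⟧ v s σ) (eval-⟦⟧ v t σ)

  all-assignments : (k : ℕ) → (Vec Bool k → Bool) → Bool
  all-assignments zero    f = f []
  all-assignments (suc k) f = all-assignments k (f ∘ (true ∷_)) ∧ all-assignments k (f ∘ (false ∷_))

  all-assignments-sound : ∀ {f} → T (all-assignments k f) → ∀ ρ → T (f ρ)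
  all-assignments-sound {zero}  t []          = t
  all-assignments-sound {suc k} t (true ∷ ρ)  = all-assignments-sound (proj₁ (to T-∧ t)) ρ
  all-assignments-sound {suc k} t (false ∷ ρ) = all-assignments-sound (proj₂ (to T-∧ t)) ρ

  -- The validity proof is an implicit unit: Agda fills it in by running the truth table.
  ⊢-instance : (s : Schema k) → {T (all-assignments k (value s))} → (σ : Vec Formula k) → ⊢ ⟦ s ⟧ σ
  ⊢-instance s {valid} σ =
    taut λ v → trans (eval-⟦⟧ v s σ) (to T-≡ (all-assignments-sound valid (Vec.map (D.eval n v) σ)))

  ⊢-⊤ : ⊢ ⊤′
  ⊢-⊤ = ⊢-instance verum []

  ⊢-weaken : ⊢ B → ⊢ A ⇒ B
  ⊢-weaken {B} {A} = mp (⊢-instance (p ⇛ q ⇛ p) (B ∷ A ∷ []))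

  ⊢-⊤-elim : ⊢ ⊤′ ⇒ A → ⊢ A
  ⊢-⊤-elim {A} = mp (⊢-instance ((verum ⇛ p) ⇛ p) (A ∷ []))

  ⊢-trans : ⊢ A ⇒ B → ⊢ B ⇒ C → ⊢ A ⇒ C
  ⊢-trans {A} {B} {C} = mp ∘ mp (⊢-instance ((p ⇛ q) ⇛ (q ⇛ r) ⇛ p ⇛ r) (A ∷ B ∷ C ∷ []))

  ⊢-∧-intro : ⊢ A ⇒ B → ⊢ A ⇒ C → ⊢ A ⇒ B ∧' C
  ⊢-∧-intro {A} {B} {C} = mp ∘ mp (⊢-instance ((p ⇛ q) ⇛ (p ⇛ r) ⇛ p ⇛ q ⋀ r) (A ∷ B ∷ C ∷ []))

  ⊢-∧-elimˡ : ⊢ A ∧' B ⇒ A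
  ⊢-∧-elimˡ {A} {B} = ⊢-instance (p ⋀ q ⇛ p) (A ∷ B ∷ [])

  ⊢-∧-elimʳ : ⊢ A ∧' B ⇒ B
  ⊢-∧-elimʳ {A} {B} = ⊢-instance (p ⋀ q ⇛ q) (A ∷ B ∷ [])

  ⊢-∧-mp : ⊢ A ∧' (A ⇒ B) ⇒ B
  ⊢-∧-mp {A} {B} = ⊢-instance (p ⋀ (p ⇛ q) ⇛ q) (A ∷ B ∷ [])

  ⊢-K-∧ : ⊢ K a A ⇒ K a B ⇒ K a (A ∧' B)
  ⊢-K-∧ {a} {A} {B} =
    ⊢-trans (mp axK (nec (⊢-instance (p ⇛ q ⇛ p ⋀ q) (A ∷ B ∷ [])))) axK

  conj : List Formula → Formula
  conj = D.conj n

  infix 3 _⊢ˢ_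
  _⊢ˢ_ : Theory → Formula → Set
  Γ ⊢ˢ A = Σ (List Formula) λ L → All Γ L × (⊢ conj L ⇒ A)

  Consistent : Theory → Set
  Consistent = D.Consistent n

  ⊢-conj-++ˡ : ∀ L M → ⊢ conj (L ++ M) ⇒ conj L
  ⊢-conj-++ˡ []      M = ⊢-weaken ⊢-⊤
  ⊢-conj-++ˡ (x ∷ L) M = ⊢-∧-intro ⊢-∧-elimˡ (⊢-trans ⊢-∧-elimʳ (⊢-conj-++ˡ L M))

  ⊢-conj-++ʳ : ∀ L M → ⊢ conj (L ++ M) ⇒ conj M
  ⊢-conj-++ʳ []      M = ⊢-instance (p ⇛ p) (conj M ∷ [])
  ⊢-conj-++ʳ (x ∷ L) M = ⊢-trans ⊢-∧-elimʳ (⊢-conj-++ʳ L M)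

  ⊢ˢ-theorem : ⊢ A → Γ ⊢ˢ A
  ⊢ˢ-theorem ⊢A = [] , [] , ⊢-weaken ⊢A

  ⊢ˢ-member : Γ A → Γ ⊢ˢ A
  ⊢ˢ-member A∈Γ = _ ∷ [] , A∈Γ ∷ [] , ⊢-∧-elimˡ

  ⊢ˢ-mono : Γ ⊆ Δ → Γ ⊢ˢ A → Δ ⊢ˢ A
  ⊢ˢ-mono Γ⊆Δ (L , L⊆Γ , ⊢L⇒A) = L , All.map Γ⊆Δ L⊆Γ , ⊢L⇒A

  ⊢ˢ-mp : Γ ⊢ˢ A → ⊢ A ⇒ B → Γ ⊢ˢ B
  ⊢ˢ-mp (L , L⊆Γ , ⊢L⇒A) ⊢A⇒B = L , L⊆Γ , ⊢-trans ⊢L⇒A ⊢A⇒B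

  ⊢ˢ-∧-intro : Γ ⊢ˢ A → Γ ⊢ˢ B → Γ ⊢ˢ A ∧' B
  ⊢ˢ-∧-intro (L , L⊆Γ , ⊢L⇒A) (M , M⊆Γ , ⊢M⇒B) =
    L ++ M , ++⁺ L⊆Γ M⊆Γ ,
    ⊢-∧-intro (⊢-trans (⊢-conj-++ˡ L M) ⊢L⇒A) (⊢-trans (⊢-conj-++ʳ L M) ⊢M⇒B)

  ⊢ˢ-mp′ : Γ ⊢ˢ A → Γ ⊢ˢ A ⇒ B → Γ ⊢ˢ B
  ⊢ˢ-mp′ ⊢A ⊢A⇒B = ⊢ˢ-mp (⊢ˢ-∧-intro ⊢A ⊢A⇒B) ⊢-∧-mp

  deduction-conj : ∀ L → All (Γ ∪ ｛ ψ ｝) L → Γ ⊢ˢ ψ ⇒ conj L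
  deduction-conj [] [] = ⊢ˢ-theorem (⊢-weaken ⊢-⊤)
  deduction-conj {ψ = ψ} (x ∷ L) (inj₁ x∈Γ ∷ L⊆) =
    ⊢ˢ-mp (⊢ˢ-∧-intro (⊢ˢ-member x∈Γ) (deduction-conj L L⊆))
          (⊢-instance (p ⋀ (q ⇛ r) ⇛ q ⇛ p ⋀ r) (x ∷ ψ ∷ conj L ∷ []))
  deduction-conj {ψ = ψ} (x ∷ L) (inj₂ refl ∷ L⊆) =
    ⊢ˢ-mp (deduction-conj L L⊆) (⊢-instance ((p ⇛ q) ⇛ p ⇛ p ⋀ q) (ψ ∷ conj L ∷ []))

  deduction : Γ ∪ ｛ ψ ｝ ⊢ˢ B → Γ ⊢ˢ ψ ⇒ B
  deduction {ψ = ψ} {B = B} (L , L⊆ , ⊢L⇒B) =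
    ⊢ˢ-mp (deduction-conj L L⊆) (mp (⊢-instance ((q ⇛ r) ⇛ (p ⇛ q) ⇛ p ⇛ r) (ψ ∷ conj L ∷ B ∷ [])) ⊢L⇒B)

  consistent-∪-¬ : ¬ (Γ ⊢ˢ A) → Consistent (Γ ∪ ｛ ~ A ｝)
  consistent-∪-¬ {A = A} Γ⊬A ⊢⊥ =
    Γ⊬A (⊢ˢ-mp (deduction ⊢⊥) (⊢-instance ((neg p ⇛ falsum) ⇛ p) (A ∷ [])))

  ∅-⊢ˢ⇒⊢ : ∅ ⊢ˢ A → ⊢ A
  ∅-⊢ˢ⇒⊢ ([] , [] , ⊢⊤⇒A) = ⊢-⊤-elim ⊢⊤⇒A

  IsMCS : Theory → Set₁
  IsMCS = D.IsMCS n

  MCS : Set₁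
  MCS = D.MCS n

  module MCS-properties (m : IsMCS Γ) where

    consistent-∪⇒∈ : Consistent (Γ ∪ ｛ A ｝) → Γ A
    consistent-∪⇒∈ {A} cons = proj₂ m (Γ ∪ ｛ A ｝) cons (λ _ → inj₁) A (inj₂ refl)

    ⊢ˢ⇒∈ : Γ ⊢ˢ A → Γ A
    ⊢ˢ⇒∈ Γ⊢A = consistent-∪⇒∈ λ Γ,A⊢⊥ → proj₁ m (⊢ˢ-mp′ Γ⊢A (deduction Γ,A⊢⊥))

    ⊢⇒∈ : ⊢ A → Γ A
    ⊢⇒∈ = ⊢ˢ⇒∈ ∘ ⊢ˢ-theorem

    ∈-⊢mp : Γ A → ⊢ A ⇒ B → Γ B
    ∈-⊢mp A∈Γ ⊢A⇒B = ⊢ˢ⇒∈ (⊢ˢ-mp (⊢ˢ-member A∈Γ) ⊢A⇒B)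

    ∈-mp : Γ A → Γ (A ⇒ B) → Γ B
    ∈-mp A∈Γ A⇒B∈Γ = ⊢ˢ⇒∈ (⊢ˢ-mp′ (⊢ˢ-member A∈Γ) (⊢ˢ-member A⇒B∈Γ))

    ∈-∧-intro : Γ A → Γ B → Γ (A ∧' B)
    ∈-∧-intro A∈Γ B∈Γ = ⊢ˢ⇒∈ (⊢ˢ-∧-intro (⊢ˢ-member A∈Γ) (⊢ˢ-member B∈Γ))

    ∧-∈⇔ : Γ (A ∧' B) ⇔ (Γ A × Γ B)
    ∧-∈⇔ = mk⇔ (λ A∧B∈Γ → ∈-⊢mp A∧B∈Γ ⊢-∧-elimˡ , ∈-⊢mp A∧B∈Γ ⊢-∧-elimʳ)
               (λ (A∈Γ , B∈Γ) → ∈-∧-intro A∈Γ B∈Γ)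

    ~∈⇒∉ : Γ (~ A) → ¬ Γ A
    ~∈⇒∉ {A} ~A∈Γ A∈Γ =
      proj₁ m (⊢ˢ-mp (⊢ˢ-member (∈-∧-intro A∈Γ ~A∈Γ)) (⊢-instance (p ⋀ neg p ⇛ falsum) (A ∷ [])))

    ∉⇒~∈ : ¬ Γ A → Γ (~ A)
    ∉⇒~∈ A∉Γ = consistent-∪⇒∈ (consistent-∪-¬ (A∉Γ ∘ ⊢ˢ⇒∈))

    ~-∈⇔∉ : Γ (~ A) ⇔ (¬ Γ A)
    ~-∈⇔∉ = mk⇔ ~∈⇒∉ ∉⇒~∈

    ¬¬∈⇒∈ : ¬ ¬ Γ A → Γ A
    ¬¬∈⇒∈ {A} ¬¬A∈Γ = ∈-⊢mp (∉⇒~∈ (¬¬A∈Γ ∘ ~∈⇒∉)) (⊢-instance (neg (neg p) ⇛ p) (A ∷ []))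

    ⇒-∈-intro : (Γ A → Γ B) → Γ (A ⇒ B)
    ⇒-∈-intro A∈⇒B∈ = ∉⇒~∈ λ A∧~B∈Γ →
      let A∈Γ , ~B∈Γ = to ∧-∈⇔ A∧~B∈Γ in ~∈⇒∉ ~B∈Γ (A∈⇒B∈ A∈Γ)

    K-conj-∈ : ∀ L → All (λ χ → Γ (K a χ)) L → Γ (K a (conj L))
    K-conj-∈ []      []             = ⊢⇒∈ (nec ⊢-⊤)
    K-conj-∈ (x ∷ L) (Kx∈Γ ∷ KL⊆Γ) = ∈-mp (K-conj-∈ L KL⊆Γ) (∈-⊢mp Kx∈Γ ⊢-K-∧)

    K-closed : (λ χ → Γ (K a χ)) ⊢ˢ A → Γ (K a A)
    K-closed (L , KL⊆Γ , ⊢L⇒A) = ∈-⊢mp (K-conj-∈ L KL⊆Γ) (mp axK (nec ⊢L⇒A))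

  -- φ is added exactly when this keeps Δ consistent; the case distinction lives in the
  -- membership proof, so consistency never has to be decided.
  extend : Theory → Formula → Theory
  extend Δ φ = Δ ∪ λ χ → φ ≡ χ × Consistent (Δ ∪ ｛ φ ｝)

  extend-⊆-∪ : extend Δ φ ⊆ Δ ∪ ｛ φ ｝
  extend-⊆-∪ (inj₁ χ∈Δ)       = inj₁ χ∈Δ
  extend-⊆-∪ (inj₂ (φ≡χ , _)) = inj₂ φ≡χ

  All-extend : ∀ L → All (extend Δ φ) L → All Δ L ⊎ Consistent (Δ ∪ ｛ φ ｝)
  All-extend []      []                     = inj₁ []
  All-extend (x ∷ L) (inj₂ (_ , cons) ∷ L⊆) = inj₂ cons
  All-extend (x ∷ L) (inj₁ x∈Δ ∷ L⊆) with All-extend L L⊆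
  ... | inj₁ L⊆Δ = inj₁ (x∈Δ ∷ L⊆Δ)
  ... | inj₂ cons = inj₂ cons

  extend-consistent : Consistent Δ → Consistent (extend Δ φ)
  extend-consistent cons (L , L⊆ , ⊢L⇒⊥) with All-extend L L⊆
  ... | inj₁ L⊆Δ  = cons (L , L⊆Δ , ⊢L⇒⊥)
  ... | inj₂ cons′ = cons′ (L , All.map extend-⊆-∪ L⊆ , ⊢L⇒⊥)

  extend-all : Theory → List Formula → Theory
  extend-all Δ []      = Δ
  extend-all Δ (x ∷ L) = extend-all (extend Δ x) L

  extend-all-consistent : ∀ L → Consistent Δ → Consistent (extend-all Δ L)
  extend-all-consistent []      cons = cons
  extend-all-consistent (x ∷ L) cons = extend-all-consistent L (extend-consistent cons)

  extend-all-⊇ : ∀ L → Δ ⊆ extend-all Δ L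
  extend-all-⊇ []      = λ χ∈Δ → χ∈Δ
  extend-all-⊇ (x ∷ L) = extend-all-⊇ L ∘ inj₁

  extend-all-maximal : ∀ L → Consistent Θ → extend-all Δ L ⊆ Θ → χ ∈ L → Θ χ → extend-all Δ L χ
  extend-all-maximal {Θ = Θ} {Δ = Δ} (x ∷ L) cons ⊆Θ (here refl) x∈Θ =
    extend-all-⊇ L (inj₂ (refl , λ ⊢⊥ → cons (⊢ˢ-mono Δ,x⊆Θ ⊢⊥)))
    where
    Δ,x⊆Θ : Δ ∪ ｛ x ｝ ⊆ Θ
    Δ,x⊆Θ (inj₁ y∈Δ) = ⊆Θ (extend-all-⊇ L (inj₁ y∈Δ))
    Δ,x⊆Θ (inj₂ refl) = x∈Θ
  extend-all-maximal (x ∷ L) cons ⊆Θ (there χ∈L) χ∈Θ = extend-all-maximal L cons ⊆Θ χ∈L χ∈Θ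

  mutual
    formulas : ℕ → List Formula
    formulas zero    = []
    formulas (suc k) = formulas k ++ concat (formulas-layers k)

    formulas-layers : ℕ → List (List Formula)
    formulas-layers k =
        (var k ∷ [])
      ∷ map ~_ (formulas k)
      ∷ cartesianProductWith _∧'_ (formulas k) (formulas k)
      ∷ cartesianProductWith K (allFin n) (formulas k)
      ∷ cartesianProductWith S (allFin n) (formulas k)
      ∷ []

  ∈-formulas-suc : ∀ {xs} → χ ∈ xs → xs ∈ formulas-layers k → χ ∈ formulas (suc k)
  ∈-formulas-suc {k = k} χ∈xs xs∈ = ∈-++⁺ʳ (formulas k) (∈-concat⁺′ {xss = formulas-layers k} χ∈xs xs∈)

  rank : Formula → ℕ
  rank (var i)  = suc i
  rank (~ φ)    = suc (rank φ)
  rank (φ ∧' ψ) = suc (rank φ ⊔ rank ψ)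
  rank (K a φ)  = suc (rank φ)
  rank (S a φ)  = suc (rank φ)

  formulas-mono : ∀ {j} → k ≤′ j → χ ∈ formulas k → χ ∈ formulas j
  formulas-mono ≤′-refl        χ∈ = χ∈
  formulas-mono (≤′-step k≤′j) χ∈ = ∈-++⁺ˡ (formulas-mono k≤′j χ∈)

  ∈-formulas-rank : ∀ χ → χ ∈ formulas (rank χ)
  ∈-formulas-rank (var i)  = ∈-formulas-suc (here refl) (here refl)
  ∈-formulas-rank (~ φ)    = ∈-formulas-suc (∈-map⁺ ~_ (∈-formulas-rank φ)) (there (here refl))
  ∈-formulas-rank (φ ∧' ψ) =
    ∈-formulas-suc (∈-cartesianProductWith⁺ _∧'_ φ∈ ψ∈) (there (there (here refl)))
    where
    φ∈ : φ ∈ formulas (rank φ ⊔ rank ψ)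
    φ∈ = formulas-mono (≤⇒≤′ (m≤m⊔n (rank φ) (rank ψ))) (∈-formulas-rank φ)
    ψ∈ : ψ ∈ formulas (rank φ ⊔ rank ψ)
    ψ∈ = formulas-mono (≤⇒≤′ (m≤n⊔m (rank φ) (rank ψ))) (∈-formulas-rank ψ)
  ∈-formulas-rank (K a φ)  =
    ∈-formulas-suc (∈-cartesianProductWith⁺ K (∈-allFin a) (∈-formulas-rank φ))
                   (there (there (there (here refl))))
  ∈-formulas-rank (S a φ)  =
    ∈-formulas-suc (∈-cartesianProductWith⁺ S (∈-allFin a) (∈-formulas-rank φ))
                   (there (there (there (there (here refl)))))

  module Lindenbaum (Δ : Theory) where

    stage : ℕ → Theory
    stage zero    = Δ
    stage (suc k) = extend-all (stage k) (formulas k)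

    stage-mono : ∀ {j} → k ≤′ j → stage k ⊆ stage j
    stage-mono              ≤′-refl        = λ χ∈ → χ∈
    stage-mono {j = suc j} (≤′-step k≤′j) = extend-all-⊇ (formulas j) ∘ stage-mono k≤′j

    stage-consistent : Consistent Δ → ∀ k → Consistent (stage k)
    stage-consistent cons zero    = cons
    stage-consistent cons (suc k) = extend-all-consistent (formulas k) (stage-consistent cons k)

    limit : Theory
    limit χ = ∃[ k ] stage k χ

    All-limit⇒All-stage : ∀ L → All limit L → ∃[ k ] All (stage k) L
    All-limit⇒All-stage []      []                 = 0 , []
    All-limit⇒All-stage (x ∷ L) ((j , x∈) ∷ L⊆) with All-limit⇒All-stage L L⊆
    ... | k , L⊆stage = j ⊔ k , stage-mono (≤⇒≤′ (m≤m⊔n j k)) x∈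
                               ∷ All.map (stage-mono (≤⇒≤′ (m≤n⊔m j k))) L⊆stage

    limit-consistent : Consistent Δ → Consistent limit
    limit-consistent cons (L , L⊆ , ⊢L⇒⊥) with All-limit⇒All-stage L L⊆
    ... | k , L⊆stage = stage-consistent cons k (L , L⊆stage , ⊢L⇒⊥)

    limit-maximal : ∀ Θ → Consistent Θ → limit ⊆ Θ → Θ ⊆ limit
    limit-maximal Θ cons limit⊆Θ {χ} χ∈Θ =
      suc (rank χ) ,
      extend-all-maximal (formulas (rank χ)) cons (limit⊆Θ ∘ (suc (rank χ) ,_)) (∈-formulas-rank χ) χ∈Θ

  lindenbaum : Consistent Δ → Σ[ Γ ∈ MCS ] Δ ⊆ proj₁ Γ
  lindenbaum {Δ} cons =
    (limit , limit-consistent cons , λ Θ consΘ ⊆Θ _ → limit-maximal Θ consΘ (⊆Θ _)) , (0 ,_)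
    where open Lindenbaum Δ

  open MCS-properties

  R : Fin n → MCS → MCS → Set
  R = D.R n

  SameVertex : Fin n → MCS → MCS → Set₁
  SameVertex = D.SameVertex n

  R-refl : ∀ X → R a X X
  R-refl (Γ , m) φ Kφ∈Γ = ∈-⊢mp m Kφ∈Γ axT

  R⇒SameVertex : ∀ X Y → R a X Y → SameVertex a X Y
  R⇒SameVertex {a} (Γ , m) (Δ , mΔ) ΓRΔ Θ = mk⇔
    (λ ΓRΘ χ Kχ∈Δ → ΓRΘ χ (¬¬∈⇒∈ m λ Kχ∉Γ → ~∈⇒∉ mΔ (ΓRΔ _ (∈-⊢mp m (∉⇒~∈ m Kχ∉Γ) ax5)) Kχ∈Δ))
    (λ ΔRΘ χ Kχ∈Γ → ΔRΘ χ (ΓRΔ (K a χ) (∈-⊢mp m Kχ∈Γ ax4)))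

  SameVertex⇒R : ∀ X Y → SameVertex a X Y → R a X Y
  SameVertex⇒R X Y X~Y = from (X~Y Y) (R-refl Y)

  K-∈⇔ : (X : MCS) → proj₁ X (K a φ) ⇔ (∀ (Y : MCS) → SameVertex a X Y → proj₁ Y φ)
  K-∈⇔ {a} {φ} X@(Γ , m) = mk⇔
    (λ Kφ∈Γ Y X~Y → SameVertex⇒R X Y X~Y φ Kφ∈Γ)
    (λ φ∈[Γ] → ¬¬∈⇒∈ m λ Kφ∉Γ →
      let Y , ⊆Y = lindenbaum (consistent-∪-¬ {Γ = λ χ → Γ (K a χ)} (Kφ∉Γ ∘ K-closed m))
      in ~∈⇒∉ (proj₂ Y) (⊆Y (inj₂ refl)) (φ∈[Γ] Y (R⇒SameVertex X Y (λ χ → ⊆Y ∘ inj₁))))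

  ∈-every-MCS⇒¬¬⊢ : (∀ (Y : MCS) → proj₁ Y A) → ¬ ¬ (⊢ A)
  ∈-every-MCS⇒¬¬⊢ A∈every ⊬A =
    let Y , ⊆Y = lindenbaum (consistent-∪-¬ {Γ = ∅} (⊬A ∘ ∅-⊢ˢ⇒⊢))
    in ~∈⇒∉ (proj₂ Y) (⊆Y (inj₂ refl)) (A∈every Y)

  S-∈-intro : (X : MCS) → proj₁ X (S a ψ) → (∀ (Y : MCS) → proj₁ Y φ ⇔ proj₁ Y ψ) → proj₁ X (S a φ)
  S-∈-intro {a = a} {ψ = ψ} {φ = φ} (Γ , m) Sψ∈Γ φ̂≡ψ̂ = ¬¬∈⇒∈ m λ Sφ∉Γ →
    ∈-every-MCS⇒¬¬⊢ φ⇔ψ∈every λ ⊢φ⇔ψ → Sφ∉Γ (∈-⊢mp m Sψ∈Γ (mp ⊢-∧-elimʳ (reS ⊢φ⇔ψ)))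
    where
    φ⇔ψ∈every : ∀ Y → proj₁ Y (φ ⇔′ ψ)
    φ⇔ψ∈every Y@(_ , mY) = ∈-∧-intro mY (⇒-∈-intro mY (to (φ̂≡ψ̂ Y))) (⇒-∈-intro mY (from (φ̂≡ψ̂ Y)))

  _⊩_ : MCS → Formula → Set₁
  _⊩_ = D._⊩_ n

  ⊩K⇔∈ : (∀ Y → (Y ⊩ φ) ⇔ proj₁ Y φ) → ∀ X → (X ⊩ K a φ) ⇔ proj₁ X (K a φ)
  ⊩K⇔∈ truth X = mk⇔
    (λ X⊩Kφ → from (K-∈⇔ X) λ Y X~Y → to (truth Y) (X⊩Kφ Y X~Y))
    (λ Kφ∈X Y X~Y → from (truth Y) (to (K-∈⇔ X) Kφ∈X Y X~Y))

  truth-lemma : ∀ φ X → (X ⊩ φ) ⇔ proj₁ X φ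
  truth-lemma (var i)  X       = mk⇔ lower lift
  truth-lemma (~ φ)    (Γ , m) = ⇔-sym (~-∈⇔∉ m) ⇔-∘ ¬-cong-⇔ (truth-lemma φ (Γ , m))
  truth-lemma (φ ∧' ψ) (Γ , m) = ⇔-sym (∧-∈⇔ m) ⇔-∘ (truth-lemma φ (Γ , m) ×-⇔ truth-lemma ψ (Γ , m))
  truth-lemma (K a φ)  X       = ⊩K⇔∈ (truth-lemma φ) X
  truth-lemma (S a φ)  X       = mk⇔
    (λ (_ , ψ , Sψ∈X , φ̂≡ψ̂) → S-∈-intro X Sψ∈X λ Y → φ̂≡ψ̂ Y ⇔-∘ ⇔-sym (truth-lemma φ Y))
    (λ Sφ∈X → from (⊩K⇔∈ (truth-lemma φ) X) (∈-⊢mp (proj₂ X) Sφ∈X axS1) , φ , Sφ∈X , truth-lemma φ)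

open D using (IsMCS; _⊩_)

-- The hypothesis 2 ≤ n is only needed for axiom S2, which the truth lemma never uses.
lemma5p16 : (n : ℕ) → 2 ≤ n → (Γ : Fm n → Set) (m : IsMCS n Γ) (φ : Fm n) →
    _⊩_ n (Γ , m) φ ⇔ Γ φ
lemma5p16 n _ Γ m φ = Canonical.truth-lemma φ (Γ , m)
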